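{- ${\bf ITL}^{1}$ and ${\bf ITL}^{1}_\Box$ are sound for the class of persistent dynamic posets.
   Context: Formulas of $\mathcal L$ are built from propositional variables and $\bot$ by $\wedge,\vee,\to,\circ,\Diamond,\Box$; $\mathcal L_\Box$ is the $\Diamond$-free fragment. ${\bf ITL}^0$ is axiomatized by all intuitionistic tautologies, $\neg\circ\bot$, $\circ(\varphi\wedge\psi)\leftrightarrow(\circ\varphi\wedge\circ\psi)$, $\circ(\varphi\vee\psi)\leftrightarrow(\circ\varphi\vee\circ\psi)$, $\circ(\varphi\to\psi)\to(\circ\varphi\to\circ\psi)$, $\Box(\varphi\to\psi)\to(\Box\varphi\to\Box\psi)$, $\Box(\varphi\to\psi)\to(\Diamond\varphi\to\Diamond\psi)$, $\Diamond(\varphi\vee\psi)\to(\Diamond\varphi\vee\Diamond\psi)$, $\Box\varphi\to\varphi\wedge\circ\Box\varphi$, $\varphi\vee\circ\Diamond\varphi\to\Diamond\varphi$, with rules: from $\varphi\to\circ\varphi$ infer $\varphi\to\Box\varphi$; from $\circ\varphi\to\varphi$ infer $\Diamond\varphi\to\varphi$; modus ponens; from $\varphi$ infer $\circ\varphi$. ${\bf ITL}^1={\bf ITL}^0+{\rm FS}_\circ+{\rm FS}_\Diamond+{\rm CD}$, where ${\rm FS}_\circ(\varphi,\psi)$ is $(\circ\varphi\to\circ\psi)\to\circ(\varphi\to\psi)$, ${\rm FS}_\Diamond(\varphi,\psi)$ is $(\Diamond\varphi\to\Box\psi)\to\Box(\varphi\to\psi)$, and ${\rm CD}(\varphi,\psi)$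 is $\Box(\varphi\vee\psi)\to\Box\varphi\vee\Diamond\psi$. ${\bf ITL}^1_\Box$ restricts all rules and axioms to $\mathcal L_\Box$ and adds ${\rm BI}(\varphi,\psi)$: $\Box(\varphi\vee\psi)\wedge\Box(\circ\psi\to\psi)\to\Box\varphi\vee\psi$. A persistent dynamic poset is $(W,\preccurlyeq,S)$ with $\preccurlyeq$ a partial order (with its up-set topology, open = upward closed) and $S$ continuous and open, i.e. $w\preccurlyeq w'$ implies $S(w)\preccurlyeq S(w')$, and whenever $S(w)\preccurlyeq v$ there is $w'\succcurlyeq w$ with $S(w')=v$. Valuations $[\![\cdot]\!]$ map formulas to open sets: $[\![\bot]\!]=\varnothing$, $\cap$ for $\wedge$, $\cup$ for $\vee$, $[\![\varphi\to\psi]\!]=((W\setminus[\![\varphi]\!])\cup[\![\psi]\!])^\circ$, $[\![\circ\varphi]\!]=S^{ -1}[\![\varphi]\!]$, $[\![\Diamond\varphi]\!]=\bigcup_{n\ge0}S^{ -n}[\![\varphi]\!]$, $[\![\Box\varphi]\!]=\bigcup\{U\text{ open}:S[U]\subseteq U\subseteq[\![\varphi]\!]\}$. Soundness: every derivable formula is true everywhere under every valuation on every structure of the class. -}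

module Defs where

open import Level using (0ℓ)
open import Data.Nat using (ℕ; zero; suc)
open import Data.Product using (Σ; _×_; _,_)
open import Data.Sum using (_⊎_)
open import Data.Empty renaming (⊥ to Empty)
open import Relation.Nullary using (¬_)
open import Relation.Binary.PropositionalEquality using (_≡_)
open import Relation.Binary.Structures using (IsPartialOrder)
open import Axiom.ExcludedMiddle using (ExcludedMiddle)

infixr 4 _⇒_
infixr 5 _∨'_
infixr 6 _∧'_

data Fm : Set where
  var   : ℕ → Fm
  ⊥'    : Fm
  _∧'_  : Fm → Fm → Fm
  _∨'_  : Fm → Fm → Fm
  _⇒_   : Fm → Fm → Fm
  ○     : Fm → Fm
  ◇     : Fm → Fm
  □     : Fm → Fm

¬' : Fm → Fm
¬' φ = φ ⇒ ⊥'

_⇔_ : Fm → Fm → Fm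
φ ⇔ ψ = (φ ⇒ ψ) ∧' (ψ ⇒ φ)

data ◇Free : Fm → Set where
  var  : ∀ n → ◇Free (var n)
  ⊥'   : ◇Free ⊥'
  _∧'_ : ∀ {φ ψ} → ◇Free φ → ◇Free ψ → ◇Free (φ ∧' ψ)
  _∨'_ : ∀ {φ ψ} → ◇Free φ → ◇Free ψ → ◇Free (φ ∨' ψ)
  _⇒_  : ∀ {φ ψ} → ◇Free φ → ◇Free ψ → ◇Free (φ ⇒ ψ)
  ○    : ∀ {φ} → ◇Free φ → ◇Free (○ φ)
  □    : ∀ {φ} → ◇Free φ → ◇Free (□ φ)

-- Axioms of ITL⁰.  "All intuitionistic tautologies" (in the language L)
-- is given by a standard complete Hilbert axiomatisation of intuitionistic
-- propositional logic (all L-instances of the schemes below); together with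
-- modus ponens these derive exactly the L-substitution instances of
-- intuitionistic propositional tautologies.

data ITL0Ax : Fm → Set where
  ipc-k    : ∀ φ ψ → ITL0Ax (φ ⇒ ψ ⇒ φ)
  ipc-s    : ∀ φ ψ χ → ITL0Ax ((φ ⇒ ψ ⇒ χ) ⇒ (φ ⇒ ψ) ⇒ φ ⇒ χ)
  ipc-∧e₁  : ∀ φ ψ → ITL0Ax (φ ∧' ψ ⇒ φ)
  ipc-∧e₂  : ∀ φ ψ → ITL0Ax (φ ∧' ψ ⇒ ψ)
  ipc-∧i   : ∀ φ ψ → ITL0Ax (φ ⇒ ψ ⇒ φ ∧' ψ)
  ipc-∨i₁  : ∀ φ ψ → ITL0Ax (φ ⇒ φ ∨' ψ)
  ipc-∨i₂  : ∀ φ ψ → ITL0Ax (ψ ⇒ φ ∨' ψ)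
  ipc-∨e   : ∀ φ ψ χ → ITL0Ax ((φ ⇒ χ) ⇒ (ψ ⇒ χ) ⇒ φ ∨' ψ ⇒ χ)
  ipc-⊥e   : ∀ φ → ITL0Ax (⊥' ⇒ φ)
  ¬○⊥      : ITL0Ax (¬' (○ ⊥'))
  ○∧       : ∀ φ ψ → ITL0Ax (○ (φ ∧' ψ) ⇔ (○ φ ∧' ○ ψ))
  ○∨       : ∀ φ ψ → ITL0Ax (○ (φ ∨' ψ) ⇔ (○ φ ∨' ○ ψ))
  K○       : ∀ φ ψ → ITL0Ax (○ (φ ⇒ ψ) ⇒ ○ φ ⇒ ○ ψ)
  K□       : ∀ φ ψ → ITL0Ax (□ (φ ⇒ ψ) ⇒ □ φ ⇒ □ ψ)
  K◇       : ∀ φ ψ → ITL0Ax (□ (φ ⇒ ψ) ⇒ ◇ φ ⇒ ◇ ψ)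
  ◇∨       : ∀ φ ψ → ITL0Ax (◇ (φ ∨' ψ) ⇒ ◇ φ ∨' ◇ ψ)
  □fix     : ∀ φ → ITL0Ax (□ φ ⇒ φ ∧' ○ (□ φ))
  ◇fix     : ∀ φ → ITL0Ax (φ ∨' ○ (◇ φ) ⇒ ◇ φ)

FS○ : Fm → Fm → Fm
FS○ φ ψ = (○ φ ⇒ ○ ψ) ⇒ ○ (φ ⇒ ψ)

FS◇ : Fm → Fm → Fm
FS◇ φ ψ = (◇ φ ⇒ □ ψ) ⇒ □ (φ ⇒ ψ)

CD : Fm → Fm → Fm
CD φ ψ = □ (φ ∨' ψ) ⇒ □ φ ∨' ◇ ψ

BI : Fm → Fm → Fm
BI φ ψ = □ (φ ∨' ψ) ∧' □ (○ ψ ⇒ ψ) ⇒ □ φ ∨' ψ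

data ITL1Ax : Fm → Set where
  base : ∀ {φ} → ITL0Ax φ → ITL1Ax φ
  fs○  : ∀ φ ψ → ITL1Ax (FS○ φ ψ)
  fs◇  : ∀ φ ψ → ITL1Ax (FS◇ φ ψ)
  cd   : ∀ φ ψ → ITL1Ax (CD φ ψ)

data ITL1□Ax : Fm → Set where
  restr : ∀ {φ} → ITL1Ax φ → ◇Free φ → ITL1□Ax φ
  bi    : ∀ φ ψ → ◇Free (BI φ ψ) → ITL1□Ax (BI φ ψ)

-- The rule "from ○φ → φ infer ◇φ → φ"
-- is only available when `DiaRule` is inhabited (it mentions ◇, so it is
-- absent in the L_□-restricted calculus).  All other rules preserve
-- ◇-freeness, so in the restricted calculus every derivable formula is in L_□.
data Deriv (Ax : Fm → Set) (DiaRule : Set) : Fm → Set where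
  ax     : ∀ {φ} → Ax φ → Deriv Ax DiaRule φ
  mp     : ∀ {φ ψ} → Deriv Ax DiaRule (φ ⇒ ψ) → Deriv Ax DiaRule φ → Deriv Ax DiaRule ψ
  nec    : ∀ {φ} → Deriv Ax DiaRule φ → Deriv Ax DiaRule (○ φ)
  ind□   : ∀ {φ} → Deriv Ax DiaRule (φ ⇒ ○ φ) → Deriv Ax DiaRule (φ ⇒ □ φ)
  ind◇   : ∀ {φ} → DiaRule → Deriv Ax DiaRule (○ φ ⇒ φ) → Deriv Ax DiaRule (◇ φ ⇒ φ)

record ⊤' : Set where
  constructor tt'

ITL1⊢_ : Fm → Set
ITL1⊢ φ = Deriv ITL1Ax ⊤' φ

ITL1□⊢_ : Fm → Set
ITL1□⊢ φ = Deriv ITL1□Ax Empty φ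

record PersistentDynamicPoset : Set₁ where
  field
    W         : Set
    _≼_       : W → W → Set
    isPO      : IsPartialOrder _≡_ _≼_
    S         : W → W
    -- continuity (w.r.t. the up-set topology)
    S-mono    : ∀ {w w'} → w ≼ w' → S w ≼ S w'
    S-open    : ∀ {w v} → S w ≼ v → Σ W λ w' → (w ≼ w') × (S w' ≡ v)

module _ (D : PersistentDynamicPoset) where
  open PersistentDynamicPoset D

  -- open sets of the up-set topology
  IsOpen : (W → Set) → Set
  IsOpen U = ∀ {w v} → w ≼ v → U w → U v

  _⊆_ : (W → Set) → (W → Set) → Set
  U ⊆ V = ∀ w → U w → V w

  Int : (W → Set) → W → Set₁
  Int A w = Σ (W → Set) λ U → IsOpen U × (U ⊆ A) × U w

  Sⁿ : ℕ → W → W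
  Sⁿ zero    w = w
  Sⁿ (suc n) w = S (Sⁿ n w)

  -- A valuation: a map from formulas to open sets satisfying the
  -- semantic clauses (membership is stated pointwise as logical equivalence).
  record Valuation : Set₁ where
    field
      ⟦_⟧    : Fm → W → Set
      open⟦⟧ : ∀ φ → IsOpen ⟦ φ ⟧
      ⟦⊥⟧    : ∀ w → ¬ ⟦ ⊥' ⟧ w
      ⟦∧⟧→   : ∀ φ ψ w → ⟦ φ ∧' ψ ⟧ w → ⟦ φ ⟧ w × ⟦ ψ ⟧ w
      ⟦∧⟧←   : ∀ φ ψ w → ⟦ φ ⟧ w × ⟦ ψ ⟧ w → ⟦ φ ∧' ψ ⟧ w
      ⟦∨⟧→   : ∀ φ ψ w → ⟦ φ ∨' ψ ⟧ w → ⟦ φ ⟧ w ⊎ ⟦ ψ ⟧ w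
      ⟦∨⟧←   : ∀ φ ψ w → ⟦ φ ⟧ w ⊎ ⟦ ψ ⟧ w → ⟦ φ ∨' ψ ⟧ w
      ⟦⇒⟧→   : ∀ φ ψ w → ⟦ φ ⇒ ψ ⟧ w → Int (λ v → ¬ ⟦ φ ⟧ v ⊎ ⟦ ψ ⟧ v) w
      ⟦⇒⟧←   : ∀ φ ψ w → Int (λ v → ¬ ⟦ φ ⟧ v ⊎ ⟦ ψ ⟧ v) w → ⟦ φ ⇒ ψ ⟧ w
      ⟦○⟧→   : ∀ φ w → ⟦ ○ φ ⟧ w → ⟦ φ ⟧ (S w)
      ⟦○⟧←   : ∀ φ w → ⟦ φ ⟧ (S w) → ⟦ ○ φ ⟧ w
      ⟦◇⟧→   : ∀ φ w → ⟦ ◇ φ ⟧ w → Σ ℕ λ n → ⟦ φ ⟧ (Sⁿ n w)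
      ⟦◇⟧←   : ∀ φ w → Σ ℕ (λ n → ⟦ φ ⟧ (Sⁿ n w)) → ⟦ ◇ φ ⟧ w
      ⟦□⟧→   : ∀ φ w → ⟦ □ φ ⟧ w →
                 Σ (W → Set) λ U → IsOpen U × (∀ v → U v → U (S v)) × (U ⊆ ⟦ φ ⟧) × U w
      ⟦□⟧←   : ∀ φ w →
                 Σ (W → Set) (λ U → IsOpen U × (∀ v → U v → U (S v)) × (U ⊆ ⟦ φ ⟧) × U w) →
                 ⟦ □ φ ⟧ w

ValidPDP : Fm → Set₁
ValidPDP φ = (D : PersistentDynamicPoset) (V : Valuation D) →
  ∀ w → Valuation.⟦_⟧ V φ w

SoundPDP : (Fm → Set) → Set₁
SoundPDP ⊢_ = ∀ φ → ⊢ φ → ValidPDP φ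

LEM : Set₁
LEM = ExcludedMiddle 0ℓ

module Submission where

-- The valuation clauses of Defs are topological; the proof first turns them
-- into pointwise (Kripke-style) reasoning principles and then checks each
-- axiom and rule pointwise.
--   * Orbit facts about a persistent dynamic poset: S^n is shifted by S, and
--     S^n inherits openness from S ("every v ≽ S^n w is S^n w' for some w' ≽ w").
--   * Constructive semantics: modus ponens upward, and the characterisation
--     ⟦□φ⟧ w ⟺ φ holds at every S^n w, with two consequences used by the
--     induction rule for ◇, CD and BI.
--   * Classical semantics: with excluded middle, ⟦φ → ψ⟧ w follows from
--     "φ implies ψ at every v ≽ w" (the interior clause needs ¬φ ∨ ψ).
--     Excluded middle is also what makes CD and BI valid.

open import Defs
open import Data.Product using (Σ; _×_; _,_; proj₁; proj₂)
open import Data.Sum using (_⊎_; inj₁; inj₂; [_,_])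
import Data.Sum as Sum
open import Data.Nat using (ℕ; zero; suc)
open import Data.Empty using (⊥-elim)
open import Relation.Nullary using (¬_; yes; no)
open import Relation.Binary.PropositionalEquality using (_≡_; refl; subst; sym; cong)
open import Relation.Binary.Structures using (IsPartialOrder)

module OrbitFacts (D : PersistentDynamicPoset) where
  open PersistentDynamicPoset D

  ≼-refl : ∀ {w} → w ≼ w
  ≼-refl = IsPartialOrder.refl isPO

  ≼-trans : ∀ {a b c} → a ≼ b → b ≼ c → a ≼ c
  ≼-trans = IsPartialOrder.trans isPO

  Sⁿ-shift : ∀ n w → Sⁿ D n (S w) ≡ Sⁿ D (suc n) w
  Sⁿ-shift zero    w = refl
  Sⁿ-shift (suc n) w = cong S (Sⁿ-shift n w)

  Sⁿ-open : ∀ n {w v} → Sⁿ D n w ≼ v → Σ W λ w' → (w ≼ w') × (Sⁿ D n w' ≡ v)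
  Sⁿ-open zero    {v = v} w≼v = v , w≼v , refl
  Sⁿ-open (suc n) Sⁿ⁺¹w≼v with S-open Sⁿ⁺¹w≼v
  ... | x , Sⁿw≼x , refl with Sⁿ-open n Sⁿw≼x
  ...   | w' , w≼w' , refl = w' , w≼w' , refl

  Sⁿ-lift : ∀ n {w v} (P : W → Set) → Sⁿ D n w ≼ v →
            (∀ {w'} → w ≼ w' → P (Sⁿ D n w')) → P v
  Sⁿ-lift n P Sⁿw≼v k with Sⁿ-open n Sⁿw≼v
  ... | w' , w≼w' , refl = k w≼w'

  orbit-closed : (U : W → Set) → (∀ v → U v → U (S v)) → ∀ n {w} → U w → U (Sⁿ D n w)
  orbit-closed U closed zero    Uw = Uw
  orbit-closed U closed (suc n) Uw = closed _ (orbit-closed U closed n Uw)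

module Semantics (D : PersistentDynamicPoset) (V : Valuation D) where
  open PersistentDynamicPoset D
  open Valuation V
  open OrbitFacts D

  Valid : Fm → Set
  Valid φ = ∀ w → ⟦ φ ⟧ w

  ⇒E : ∀ φ ψ {w v} → ⟦ φ ⇒ ψ ⟧ w → w ≼ v → ⟦ φ ⟧ v → ⟦ ψ ⟧ v
  ⇒E φ ψ {v = v} φ⇒ψ w≼v φv with ⟦⇒⟧→ φ ψ _ φ⇒ψ
  ... | U , openU , U⊆ , Uw with U⊆ v (openU w≼v Uw)
  ...   | inj₁ ¬φv = ⊥-elim (¬φv φv)
  ...   | inj₂ ψv  = ψv

  mp-at : ∀ φ ψ {w} → ⟦ φ ⇒ ψ ⟧ w → ⟦ φ ⟧ w → ⟦ ψ ⟧ w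
  mp-at φ ψ φ⇒ψ = ⇒E φ ψ φ⇒ψ ≼-refl

  □I : ∀ φ {w} → (∀ n → ⟦ φ ⟧ (Sⁿ D n w)) → ⟦ □ φ ⟧ w
  □I φ {w} orbitφ = ⟦□⟧← φ w (AboveOrbit , openU , closed , U⊆φ , (zero , ≼-refl))
    where
    AboveOrbit : W → Set
    AboveOrbit v = Σ ℕ λ n → Sⁿ D n w ≼ v
    openU : IsOpen D AboveOrbit
    openU v≼v' (n , Sⁿw≼v) = n , ≼-trans Sⁿw≼v v≼v'
    closed : ∀ v → AboveOrbit v → AboveOrbit (S v)
    closed v (n , Sⁿw≼v) = suc n , S-mono Sⁿw≼v
    U⊆φ : _⊆_ D AboveOrbit ⟦ φ ⟧
    U⊆φ v (n , Sⁿw≼v) = open⟦⟧ φ Sⁿw≼v (orbitφ n)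

  □E : ∀ φ {w} → ⟦ □ φ ⟧ w → ∀ n → ⟦ φ ⟧ (Sⁿ D n w)
  □E φ {w} □φ n with ⟦□⟧→ φ w □φ
  ... | U , _ , closed , U⊆φ , Uw = U⊆φ _ (orbit-closed U closed n Uw)

  descend : ∀ ψ {w} → (∀ n → ⟦ ○ ψ ⇒ ψ ⟧ (Sⁿ D n w)) → ∀ n → ⟦ ψ ⟧ (Sⁿ D n w) → ⟦ ψ ⟧ w
  descend ψ step zero    ψw    = ψw
  descend ψ step (suc n) ψSⁿ⁺¹ = descend ψ step n (mp-at (○ ψ) ψ (step n) (⟦○⟧← ψ _ ψSⁿ⁺¹))

  □∨-refute : ∀ φ ψ {w} → ⟦ □ (φ ∨' ψ) ⟧ w → (∀ n → ¬ ⟦ ψ ⟧ (Sⁿ D n w)) → ⟦ □ φ ⟧ w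
  □∨-refute φ ψ □φ∨ψ ¬ψ = □I φ λ n →
    [ (λ φSⁿ → φSⁿ) , (λ ψSⁿ → ⊥-elim (¬ψ n ψSⁿ)) ] (⟦∨⟧→ φ ψ _ (□E (φ ∨' ψ) □φ∨ψ n))

module Classical (lem : LEM) (D : PersistentDynamicPoset) (V : Valuation D) where
  open PersistentDynamicPoset D
  open Valuation V
  open OrbitFacts D
  open Semantics D V

  -- Kripke introduction for →: the set of points all of whose successors
  -- satisfy φ → ψ pointwise is open and, classically, inside ¬⟦φ⟧ ∪ ⟦ψ⟧.
  ⇒I : ∀ φ ψ {w} → (∀ {v} → w ≼ v → ⟦ φ ⟧ v → ⟦ ψ ⟧ v) → ⟦ φ ⇒ ψ ⟧ w
  ⇒I φ ψ {w} k = ⟦⇒⟧← φ ψ w (Forces , openU , U⊆ , k)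
    where
    Forces : W → Set
    Forces v = ∀ {u} → v ≼ u → ⟦ φ ⟧ u → ⟦ ψ ⟧ u
    openU : IsOpen D Forces
    openU v≼v' f v'≼u = f (≼-trans v≼v' v'≼u)
    U⊆ : _⊆_ D Forces (λ v → ¬ ⟦ φ ⟧ v ⊎ ⟦ ψ ⟧ v)
    U⊆ v f with lem {⟦ φ ⟧ v}
    ... | yes φv = inj₂ (f ≼-refl φv)
    ... | no ¬φv = inj₁ ¬φv

  ⇔I : ∀ φ ψ {w} → (∀ {v} → w ≼ v → ⟦ φ ⟧ v → ⟦ ψ ⟧ v) →
       (∀ {v} → w ≼ v → ⟦ ψ ⟧ v → ⟦ φ ⟧ v) → ⟦ φ ⇔ ψ ⟧ w
  ⇔I φ ψ to from = ⟦∧⟧← (φ ⇒ ψ) (ψ ⇒ φ) _ (⇒I φ ψ to , ⇒I ψ φ from)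

  ITL0-valid : ∀ {φ} → ITL0Ax φ → Valid φ
  ITL0-valid (ipc-k φ ψ) _ = ⇒I φ (ψ ⇒ φ) λ _ φv → ⇒I ψ φ λ v≼u _ → open⟦⟧ φ v≼u φv
  ITL0-valid (ipc-s φ ψ χ) _ =
    ⇒I (φ ⇒ ψ ⇒ χ) ((φ ⇒ ψ) ⇒ φ ⇒ χ) λ _ f →
    ⇒I (φ ⇒ ψ) (φ ⇒ χ) λ p g →
    ⇒I φ χ λ q φx → mp-at ψ χ (⇒E φ (ψ ⇒ χ) f (≼-trans p q) φx) (⇒E φ ψ g q φx)
  ITL0-valid (ipc-∧e₁ φ ψ) _ = ⇒I (φ ∧' ψ) φ λ _ φψ → proj₁ (⟦∧⟧→ φ ψ _ φψ)
  ITL0-valid (ipc-∧e₂ φ ψ) _ = ⇒I (φ ∧' ψ) ψ λ _ φψ → proj₂ (⟦∧⟧→ φ ψ _ φψ)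
  ITL0-valid (ipc-∧i φ ψ) _ =
    ⇒I φ (ψ ⇒ φ ∧' ψ) λ _ φv → ⇒I ψ (φ ∧' ψ) λ q ψu → ⟦∧⟧← φ ψ _ (open⟦⟧ φ q φv , ψu)
  ITL0-valid (ipc-∨i₁ φ ψ) _ = ⇒I φ (φ ∨' ψ) λ _ φv → ⟦∨⟧← φ ψ _ (inj₁ φv)
  ITL0-valid (ipc-∨i₂ φ ψ) _ = ⇒I ψ (φ ∨' ψ) λ _ ψv → ⟦∨⟧← φ ψ _ (inj₂ ψv)
  ITL0-valid (ipc-∨e φ ψ χ) _ =
    ⇒I (φ ⇒ χ) ((ψ ⇒ χ) ⇒ φ ∨' ψ ⇒ χ) λ _ f →
    ⇒I (ψ ⇒ χ) (φ ∨' ψ ⇒ χ) λ p g →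
    ⇒I (φ ∨' ψ) χ λ q φ∨ψ →
      [ ⇒E φ χ f (≼-trans p q) , ⇒E ψ χ g q ] (⟦∨⟧→ φ ψ _ φ∨ψ)
  ITL0-valid (ipc-⊥e φ) _ = ⇒I ⊥' φ λ _ ⊥v → ⊥-elim (⟦⊥⟧ _ ⊥v)
  ITL0-valid ¬○⊥ _ = ⇒I (○ ⊥') ⊥' λ _ ○⊥ → ⊥-elim (⟦⊥⟧ _ (⟦○⟧→ ⊥' _ ○⊥))
  ITL0-valid (○∧ φ ψ) _ = ⇔I (○ (φ ∧' ψ)) (○ φ ∧' ○ ψ)
    (λ _ ○φψ → let (φS , ψS) = ⟦∧⟧→ φ ψ _ (⟦○⟧→ (φ ∧' ψ) _ ○φψ)
               in ⟦∧⟧← (○ φ) (○ ψ) _ (⟦○⟧← φ _ φS , ⟦○⟧← ψ _ ψS))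
    (λ _ ○φ○ψ → let (○φ , ○ψ) = ⟦∧⟧→ (○ φ) (○ ψ) _ ○φ○ψ
                in ⟦○⟧← (φ ∧' ψ) _ (⟦∧⟧← φ ψ _ (⟦○⟧→ φ _ ○φ , ⟦○⟧→ ψ _ ○ψ)))
  ITL0-valid (○∨ φ ψ) _ = ⇔I (○ (φ ∨' ψ)) (○ φ ∨' ○ ψ)
    (λ _ ○φψ → ⟦∨⟧← (○ φ) (○ ψ) _
                 (Sum.map (⟦○⟧← φ _) (⟦○⟧← ψ _) (⟦∨⟧→ φ ψ _ (⟦○⟧→ (φ ∨' ψ) _ ○φψ))))
    (λ _ ○φ○ψ → ⟦○⟧← (φ ∨' ψ) _ (⟦∨⟧← φ ψ _
                 (Sum.map (⟦○⟧→ φ _) (⟦○⟧→ ψ _) (⟦∨⟧→ (○ φ) (○ ψ) _ ○φ○ψ))))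
  ITL0-valid (K○ φ ψ) _ =
    ⇒I (○ (φ ⇒ ψ)) (○ φ ⇒ ○ ψ) λ _ ○φ⇒ψ → ⇒I (○ φ) (○ ψ) λ q ○φ →
      ⟦○⟧← ψ _ (⇒E φ ψ (⟦○⟧→ (φ ⇒ ψ) _ ○φ⇒ψ) (S-mono q) (⟦○⟧→ φ _ ○φ))
  ITL0-valid (K□ φ ψ) _ =
    ⇒I (□ (φ ⇒ ψ)) (□ φ ⇒ □ ψ) λ _ □φ⇒ψ → ⇒I (□ φ) (□ ψ) λ q □φ →
      □I ψ λ n → mp-at φ ψ (□E (φ ⇒ ψ) (open⟦⟧ (□ (φ ⇒ ψ)) q □φ⇒ψ) n) (□E φ □φ n)
  ITL0-valid (K◇ φ ψ) _ =
    ⇒I (□ (φ ⇒ ψ)) (◇ φ ⇒ ◇ ψ) λ _ □φ⇒ψ → ⇒I (◇ φ) (◇ ψ) λ q ◇φ →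
      let (n , φSⁿ) = ⟦◇⟧→ φ _ ◇φ
      in ⟦◇⟧← ψ _ (n , mp-at φ ψ (□E (φ ⇒ ψ) (open⟦⟧ (□ (φ ⇒ ψ)) q □φ⇒ψ) n) φSⁿ)
  ITL0-valid (◇∨ φ ψ) _ =
    ⇒I (◇ (φ ∨' ψ)) (◇ φ ∨' ◇ ψ) λ _ ◇φψ →
      let (n , φψSⁿ) = ⟦◇⟧→ (φ ∨' ψ) _ ◇φψ
      in ⟦∨⟧← (◇ φ) (◇ ψ) _
           (Sum.map (λ φSⁿ → ⟦◇⟧← φ _ (n , φSⁿ)) (λ ψSⁿ → ⟦◇⟧← ψ _ (n , ψSⁿ))
                    (⟦∨⟧→ φ ψ _ φψSⁿ))
  ITL0-valid (□fix φ) _ =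
    ⇒I (□ φ) (φ ∧' ○ (□ φ)) λ {v} _ □φ →
      ⟦∧⟧← φ (○ (□ φ)) v
        (□E φ □φ zero , ⟦○⟧← (□ φ) v (□I φ λ n →
          subst ⟦ φ ⟧ (sym (Sⁿ-shift n v)) (□E φ □φ (suc n))))
  ITL0-valid (◇fix φ) _ =
    ⇒I (φ ∨' ○ (◇ φ)) (◇ φ) λ {v} _ φ∨○◇φ →
      [ (λ φv → ⟦◇⟧← φ v (zero , φv))
      , (λ ○◇φ → let (n , φSⁿ) = ⟦◇⟧→ φ (S v) (⟦○⟧→ (◇ φ) v ○◇φ)
                 in ⟦◇⟧← φ v (suc n , subst ⟦ φ ⟧ (Sⁿ-shift n v) φSⁿ)) ]
      (⟦∨⟧→ φ (○ (◇ φ)) v φ∨○◇φ)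

  -- FS○: if ○φ → ○ψ holds at w, then φ → ψ holds at every v ≽ S w, since
  -- by openness of S such v is S w' with w' ≽ w.
  FS○-valid : ∀ φ ψ → Valid (FS○ φ ψ)
  FS○-valid φ ψ _ =
    ⇒I (○ φ ⇒ ○ ψ) (○ (φ ⇒ ψ)) λ {v} _ ○φ⇒○ψ → ⟦○⟧← (φ ⇒ ψ) v
      (⇒I φ ψ λ Sv≼u φu → Sⁿ-lift 1 (λ x → ⟦ φ ⟧ x → ⟦ ψ ⟧ x) Sv≼u
        (λ {v'} v≼v' φSv' → ⟦○⟧→ ψ v' (⇒E (○ φ) (○ ψ) ○φ⇒○ψ v≼v' (⟦○⟧← φ v' φSv'))) φu)

  -- FS◇: if ◇φ → □ψ holds at w, then φ → ψ holds along the orbit of w: a point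
  -- u ≽ S^n w satisfying φ is S^n w' with w' ≽ w, so ◇φ and hence □ψ hold at w'.
  FS◇-valid : ∀ φ ψ → Valid (FS◇ φ ψ)
  FS◇-valid φ ψ _ =
    ⇒I (◇ φ ⇒ □ ψ) (□ (φ ⇒ ψ)) λ _ ◇φ⇒□ψ → □I (φ ⇒ ψ) λ n →
      ⇒I φ ψ λ Sⁿv≼u φu → Sⁿ-lift n (λ x → ⟦ φ ⟧ x → ⟦ ψ ⟧ x) Sⁿv≼u
        (λ {v'} v≼v' φSⁿv' → □E ψ (⇒E (◇ φ) (□ ψ) ◇φ⇒□ψ v≼v' (⟦◇⟧← φ v' (n , φSⁿv'))) n) φu

  -- CD: either ψ occurs somewhere on the orbit (◇ψ), or it never does and □φ holds.
  CD-valid : ∀ φ ψ → Valid (CD φ ψ)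
  CD-valid φ ψ _ = ⇒I (□ (φ ∨' ψ)) (□ φ ∨' ◇ ψ) λ {v} _ □φ∨ψ →
    ⟦∨⟧← (□ φ) (◇ ψ) v (decide v □φ∨ψ)
    where
    decide : ∀ v → ⟦ □ (φ ∨' ψ) ⟧ v → ⟦ □ φ ⟧ v ⊎ ⟦ ◇ ψ ⟧ v
    decide v □φ∨ψ with lem {⟦ ◇ ψ ⟧ v}
    ... | yes ◇ψ = inj₂ ◇ψ
    ... | no ¬◇ψ = inj₁ (□∨-refute φ ψ □φ∨ψ λ n ψSⁿ → ¬◇ψ (⟦◇⟧← ψ v (n , ψSⁿ)))

  -- BI: either ψ holds now, or it never holds on the orbit (by backward
  -- induction with □(○ψ → ψ)) and □φ holds.
  BI-valid : ∀ φ ψ → Valid (BI φ ψ)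
  BI-valid φ ψ _ = ⇒I (□ (φ ∨' ψ) ∧' □ (○ ψ ⇒ ψ)) (□ φ ∨' ψ) λ {v} _ hyps →
    let (□φ∨ψ , □ind) = ⟦∧⟧→ (□ (φ ∨' ψ)) (□ (○ ψ ⇒ ψ)) v hyps
    in ⟦∨⟧← (□ φ) ψ v (decide v □φ∨ψ □ind)
    where
    decide : ∀ v → ⟦ □ (φ ∨' ψ) ⟧ v → ⟦ □ (○ ψ ⇒ ψ) ⟧ v → ⟦ □ φ ⟧ v ⊎ ⟦ ψ ⟧ v
    decide v □φ∨ψ □ind with lem {⟦ ψ ⟧ v}
    ... | yes ψv = inj₂ ψv
    ... | no ¬ψv = inj₁ (□∨-refute φ ψ □φ∨ψ λ n ψSⁿ →
                           ¬ψv (descend ψ (□E (○ ψ ⇒ ψ) □ind) n ψSⁿ))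

  ITL1-valid : ∀ {φ} → ITL1Ax φ → Valid φ
  ITL1-valid (base a) = ITL0-valid a
  ITL1-valid (fs○ φ ψ) = FS○-valid φ ψ
  ITL1-valid (fs◇ φ ψ) = FS◇-valid φ ψ
  ITL1-valid (cd φ ψ)  = CD-valid φ ψ

  ITL1□-valid : ∀ {φ} → ITL1□Ax φ → Valid φ
  ITL1□-valid (restr a _) = ITL1-valid a
  ITL1□-valid (bi φ ψ _)  = BI-valid φ ψ

  nec-sound : ∀ φ → Valid φ → Valid (○ φ)
  nec-sound φ ⊨φ w = ⟦○⟧← φ w (⊨φ (S w))

  -- If φ → ○φ is valid, then ⟦φ⟧ itself is an open S-closed set inside ⟦φ⟧.
  ind□-sound : ∀ φ → Valid (φ ⇒ ○ φ) → Valid (φ ⇒ □ φ)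
  ind□-sound φ ⊨step _ = ⇒I φ (□ φ) λ {v} _ φv →
    ⟦□⟧← φ v (⟦ φ ⟧ , open⟦⟧ φ , (λ x φx → ⟦○⟧→ φ x (mp-at φ (○ φ) (⊨step x) φx))
             , (λ _ φx → φx) , φv)

  ind◇-sound : ∀ φ → Valid (○ φ ⇒ φ) → Valid (◇ φ ⇒ φ)
  ind◇-sound φ ⊨step _ = ⇒I (◇ φ) φ λ {v} _ ◇φ →
    let (n , φSⁿ) = ⟦◇⟧→ φ v ◇φ in descend φ (λ _ → ⊨step _) n φSⁿ

  sound : ∀ {Ax DiaRule} → (∀ {φ} → Ax φ → Valid φ) →
          ∀ {φ} → Deriv Ax DiaRule φ → Valid φ
  sound ⊨Ax (ax a)             = ⊨Ax a
  sound ⊨Ax (mp {φ} {ψ} d e) w = mp-at φ ψ (sound ⊨Ax d w) (sound ⊨Ax e w)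
  sound ⊨Ax (nec {φ} d)        = nec-sound φ (sound ⊨Ax d)
  sound ⊨Ax (ind□ {φ} d)       = ind□-sound φ (sound ⊨Ax d)
  sound ⊨Ax (ind◇ {φ} _ d)     = ind◇-sound φ (sound ⊨Ax d)

corollary5p5 : LEM → SoundPDP ITL1⊢_ × SoundPDP ITL1□⊢_
corollary5p5 lem =
    (λ φ d D V → Classical.sound lem D V (Classical.ITL1-valid lem D V) d)
  , (λ φ d D V → Classical.sound lem D V (Classical.ITL1□-valid lem D V) d)
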